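{- For each $i\in\{1,\dots,r\}$ there is $a\in\{0,3\}$ such that for all $u\in B_i$, $v\in C_i$, $w\in D_i$: $M_{uv}=M_{vu}=M_{uw}=M_{wu}=M_{vw}=M_{wv}=a$.
   Context: Let $G=(V,R)$ be a directed graph and $M$ its adjacency matrix, where $M_{uv}=0$ if neither $(u,v)$ nor $(v,u)$ is in $R$, $1$ if only $(v,u)\in R$, $2$ if only $(u,v)\in R$, and $3$ if both. For $a\in\{0,1,2,3\}$, $a^{ -1}$ is the reverse adjacency: $0^{ -1}=0$, $1^{ -1}=2$, $2^{ -1}=1$, $3^{ -1}=3$. The algorithm refines ordered partitions of the current vertex set by vertex refinement (remove a pivot vertex $v$, split cells by adjacency counts to $v$) or set refinement (split cells by adjacency counts to a pivot cell), discarding cells with no links. Two partitions are compatible if they have the same number of cells, corresponding cells have equal sizes and equal available degree w.r.t. the current vertex set. Setting: $\mathcal{S}^0,\dots,\mathcal{S}^t$ is such a sequence of partitions of $G$. $k<l$ are backtracking levels (no singleton pivot available, no set refinement possible) such that each cell of $\mathcal{S}^l$ lies in a different cell of $\mathcal{S}^k$; assume both have $r$ cells (allowing empty cells) and $S^l_i\subseteq S^k_i$. With $p$ the pivot vertex at level $k$ and $q\ne p$ in the same pivot cell, refining $\mathcal{S}^k$ by $q$ and repeating the same refinement steps gives $\mathcal{T}^{k+1},\dots,\mathcal{T}^l$ compatible with $\mathcal{S}^{k+1},\dots,\mathcal{S}^l$; $\mathcal{T}^l=(T^l_1,\dots,T^l_r)$. For each $i$: $E_i=S^k_i\setminus S^l_i$,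 $E'_i=S^k_i\setminus T^l_i$, $A_i=E_i\cap E'_i$, $B_i=E_i\setminus A_i$, $C_i=E'_i\setminus A_i$, $D_i=S^l_i\cap T^l_i$. It is known that for each $i,j$ there is $a\in\{0,1,2,3\}$ such that for all $u\in B_i,v\in C_i,w\in D_i,u'\in B_j,v'\in C_j,w'\in D_j$: $M_{uv'}=M_{uw'}=M_{vu'}=M_{vw'}=M_{wu'}=M_{wv'}=a$ and $M_{u'v}=M_{u'w}=M_{v'u}=M_{v'w}=M_{w'u}=M_{w'v}=a^{ -1}$. -}

module Defs where

open import Level using (0ℓ)
open import Data.Nat using (ℕ)
open import Data.Fin using (Fin)
open import Data.Bool using (Bool; true; false)
open import Data.Product using (_×_; Σ)
open import Relation.Binary.PropositionalEquality using (_≡_)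
open import Relation.Nullary using (does)
open import Relation.Unary using (Pred; _∈_; _∖_; _∩_)
open import Relation.Binary using (Rel; Decidable)

data Adj : Set where
  a0 a1 a2 a3 : Adj

_⁻¹ : Adj → Adj
a0 ⁻¹ = a0
a1 ⁻¹ = a2
a2 ⁻¹ = a1
a3 ⁻¹ = a3

adjCode : Bool → Bool → Adj
adjCode false false = a0
adjCode false true  = a1
adjCode true  false = a2
adjCode true  true  = a3

M : {n : ℕ} (R : Rel (Fin n) 0ℓ) → Decidable R → Fin n → Fin n → Adj
M R R? u v = adjCode (does (R? u v)) (does (R? v u))

VSet : ℕ → Set₁
VSet n = Pred (Fin n) 0ℓ

module Sets {n r : ℕ} (Sk Sl Tl : Fin r → VSet n) where
  E E′ A B C D : Fin r → VSet n
  E  i = Sk i ∖ Sl i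
  E′ i = Sk i ∖ Tl i
  A  i = E i ∩ E′ i
  B  i = E i ∖ A i
  C  i = E′ i ∖ A i
  D  i = Sl i ∩ Tl i

KnownFact : {n r : ℕ} (R : Rel (Fin n) 0ℓ) (R? : Decidable R)
            (Sk Sl Tl : Fin r → VSet n) → Set
KnownFact {n} {r} R R? Sk Sl Tl =
  (i j : Fin r) → Σa λ a →
    ∀ {u v w u′ v′ w′} → u ∈ B i → v ∈ C i → w ∈ D i →
      u′ ∈ B j → v′ ∈ C j → w′ ∈ D j →
      (Mx u v′ ≡ a × Mx u w′ ≡ a × Mx v u′ ≡ a × Mx v w′ ≡ a × Mx w u′ ≡ a × Mx w v′ ≡ a)
      × (Mx u′ v ≡ a ⁻¹ × Mx u′ w ≡ a ⁻¹ × Mx v′ u ≡ a ⁻¹ × Mx v′ w ≡ a ⁻¹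
         × Mx w′ u ≡ a ⁻¹ × Mx w′ v ≡ a ⁻¹)
  where
  open Sets Sk Sl Tl
  Σa = Σ Adj
  Mx = M R R?

module Submission where

open import Defs
open import Level using (0ℓ)
open import Data.Nat using (ℕ)
open import Data.Fin using (Fin)
open import Data.Product using (_×_; ∃-syntax; _,_; proj₁; proj₂)
open import Data.Sum using (_⊎_; inj₁; inj₂)
open import Data.Empty using (⊥-elim)
open import Relation.Unary using (_∈_; _⊆_)
open import Relation.Binary using (Rel; Decidable)
open import Relation.Binary.PropositionalEquality using (_≡_; _≢_; refl; sym; trans)

symmetric⊎⁻¹-moving : (a : Adj) → (a ≡ a0 ⊎ a ≡ a3) ⊎ a ⁻¹ ≢ a
symmetric⊎⁻¹-moving a0 = inj₁ (inj₁ refl)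
symmetric⊎⁻¹-moving a1 = inj₂ λ ()
symmetric⊎⁻¹-moving a2 = inj₂ λ ()
symmetric⊎⁻¹-moving a3 = inj₁ (inj₂ refl)

module Diagonal {n r : ℕ} (R : Rel (Fin n) 0ℓ) (R? : Decidable R)
                (Sk Sl Tl : Fin r → VSet n) (known : KnownFact R R? Sk Sl Tl)
                (i : Fin r) where
  open Sets Sk Sl Tl

  a : Adj
  a = proj₁ (known i i)

  private
    Mx : Fin n → Fin n → Adj
    Mx = M R R?

  uniform : ∀ {u v w} → u ∈ B i → v ∈ C i → w ∈ D i →
            Mx u v ≡ a × Mx v u ≡ a × Mx u w ≡ a × Mx w u ≡ a × Mx v w ≡ a × Mx w v ≡ a
  uniform u∈B v∈C w∈D with proj₁ (proj₂ (known i i) u∈B v∈C w∈D u∈B v∈C w∈D)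
  ... | uv , uw , vu , vw , wu , wv = uv , vu , uw , wu , vw , wv

  -- M v u is both the entry M_{vu′} = a and the entry M_{v′u} = a⁻¹.
  a-self-inverse : ∀ {u v w} → u ∈ B i → v ∈ C i → w ∈ D i → a ⁻¹ ≡ a
  a-self-inverse u∈B v∈C w∈D with proj₂ (proj₂ (known i i) u∈B v∈C w∈D u∈B v∈C w∈D)
  ... | _ , _ , vu≡a⁻¹ , _ = trans (sym vu≡a⁻¹) (proj₁ (proj₂ (uniform u∈B v∈C w∈D)))

corollary1 : {n r : ℕ} (R : Rel (Fin n) 0ℓ) (R? : Decidable R)
    (Sk Sl Tl : Fin r → VSet n) →
    ((i : Fin r) → Sl i ⊆ Sk i) →
    KnownFact R R? Sk Sl Tl →
    (i : Fin r) → ∃[ a ] ((a ≡ a0 ⊎ a ≡ a3) ×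
      (∀ {u v w} → u ∈ Sets.B Sk Sl Tl i → v ∈ Sets.C Sk Sl Tl i → w ∈ Sets.D Sk Sl Tl i →
        M R R? u v ≡ a × M R R? v u ≡ a × M R R? u w ≡ a × M R R? w u ≡ a
        × M R R? v w ≡ a × M R R? w v ≡ a))
corollary1 R R? Sk Sl Tl _ known i with symmetric⊎⁻¹-moving (Diagonal.a R R? Sk Sl Tl known i)
... | inj₁ a-symmetric = a , a-symmetric , uniform
  where open Diagonal R R? Sk Sl Tl known i
-- a ∈ {1, 2} forces one of B i, C i, D i to be empty, so any witness does.
... | inj₂ a⁻¹≢a = a0 , inj₁ refl , λ u∈B v∈C w∈D → ⊥-elim (a⁻¹≢a (a-self-inverse u∈B v∈C w∈D))
  where open Diagonal R R? Sk Sl Tl known i
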